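{- Let $X$ be a finite set and $(X,\mathcal{R})$ a set system with VC dimension at most $d$, and let $\lambda\in(0,1)$ and $\Delta\ge1$ be such that for every $Y\subseteq X$ the set system $(Y,\mathcal{R}|_Y)$ has a $\lambda$-heavy $\tfrac12$-Mnet of size at most $\Delta$. Then for all $\epsilon\in(0,1)$ and $\eta\in(0,1)$, $(X,\mathcal{R})$ has a $\lambda'$-heavy $\epsilon$-Mnet of size at most \[ O\left(\frac{(2c)^d\Delta}{\epsilon^d}\max\left\{2^d,\frac1{\eta^d}\right\}\right),\qquad \text{where } \lambda'=\lambda(1-\eta),\] and $c$ is the absolute constant of Haussler's packing lemma.
   Context: A set system $(X,\mathcal{R})$ consists of a ground set $X$ and $\mathcal{R}\subseteq 2^X$; for $Y\subseteq X$, $\mathcal{R}|_Y=\{R\cap Y: R\in\mathcal{R}\}$. For a finite ground set $X$, $\lambda\in(0,1)$ and $\varepsilon\in(0,1)$, a $\lambda$-heavy $\varepsilon$-Mnet of $(X,\mathcal{R})$ is a collection $\mathcal{M}$ of subsets of $X$ such that for every $R\in\mathcal{R}$ with $|R|\ge\varepsilon|X|$ there is $M\in\mathcal{M}$ with $M\subseteq R$ and $|M|\ge\lambda|R|$. Haussler's packing lemma: there is an absolute constant $c$ such that if $(X,\mathcal{R})$ has $|X|=n$ and VC dimension at most $d_0$, and $\mathcal{S}\subseteq\mathcal{R}$ satisfies $|R_1\triangle R_2|>\delta$ for all distinct $R_1,R_2\in\mathcal{S}$ (with $\delta\le n$), then $|\mathcal{S}|\le (cn/\delta)^{d_0}$.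
   Formalization: The parameters λ, Δ, ε and η, and the constant c of Haussler's packing lemma, are taken in the rationals. -}

module Defs where

open import Data.Nat using (ℕ; zero; suc) renaming (_≤_ to _≤ℕ_)
open import Relation.Binary.PropositionalEquality using (_≡_)
open import Data.Integer using (+_)
open import Data.Rational using (ℚ; 0ℚ; 1ℚ; _*_; _≤_; _<_; _/_; _÷_; >-nonZero)
open import Data.Fin.Subset using (Subset; _⊆_; _∩_; _∪_; _─_; ∣_∣)
open import Data.List using (List; length)
open import Data.List.Membership.Propositional using (_∈_)
open import Data.List.Relation.Unary.AllPairs using (AllPairs)
open import Data.Product using (Σ; _×_; ∃)
open import Data.Rational using (NonZero; Positive; positive)
open import Data.Rational.Properties using (pos*pos⇒pos; positive⁻¹)

ℕ→ℚ : ℕ → ℚ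
ℕ→ℚ k = + k / 1

_^ℚ_ : ℚ → ℕ → ℚ
p ^ℚ zero = 1ℚ
p ^ℚ suc k = p * (p ^ℚ k)

-- A set system on ground set X = Fin n: a finite family of subsets,
-- given as a list (duplicates are harmless).
SetSystem : ℕ → Set
SetSystem n = List (Subset n)

Shattered : ∀ {n} → SetSystem n → Subset n → Set
Shattered 𝓡 S = ∀ T → T ⊆ S → Σ (Subset _) λ R → R ∈ 𝓡 × R ∩ S ≡ T

VCdim≤ : ∀ {n} → SetSystem n → ℕ → Set
VCdim≤ 𝓡 d = ∀ S → Shattered 𝓡 S → ∣ S ∣ ≤ℕ d

_△_ : ∀ {n} → Subset n → Subset n → Subset n
A △ B = (A ─ B) ∪ (B ─ A)

-- λ-heavy ε-Mnet of the restricted system (Y, 𝓡|_Y), for Y ⊆ Fin n.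
-- The elements of 𝓡|_Y are R ∩ Y (R ∈ 𝓡); the ground set has |Y| elements.
-- 𝓜 is a collection of subsets of Y.
IsMnet : ∀ {n} → Subset n → SetSystem n → ℚ → ℚ → List (Subset n) → Set
IsMnet Y 𝓡 λ' ε 𝓜 =
  (∀ {M} → M ∈ 𝓜 → M ⊆ Y) ×
  (∀ R → R ∈ 𝓡 → ε * ℕ→ℚ ∣ Y ∣ ≤ ℕ→ℚ ∣ R ∩ Y ∣ →
     Σ (Subset _) λ M → M ∈ 𝓜 × M ⊆ R ∩ Y × λ' * ℕ→ℚ ∣ R ∩ Y ∣ ≤ ℕ→ℚ ∣ M ∣)

-- c is a valid constant for Haussler's packing lemma (real δ replaced by rational δ)
HausslerConstant : ℚ → Set
HausslerConstant c =
  ∀ (n : ℕ) (𝓡 : SetSystem n) (d₀ : ℕ) → VCdim≤ 𝓡 d₀ →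
  ∀ (δ : ℚ) → (δ>0 : 0ℚ < δ) → δ ≤ ℕ→ℚ n →
  ∀ (𝓢 : List (Subset n)) → (∀ {R} → R ∈ 𝓢 → R ∈ 𝓡) →
  AllPairs (λ R₁ R₂ → δ < ℕ→ℚ ∣ R₁ △ R₂ ∣) 𝓢 →
  ℕ→ℚ (length 𝓢) ≤ ((c * ℕ→ℚ n) ÷ δ) {{>-nonZero δ>0}} ^ℚ d₀

^ℚ-pos : ∀ p → 0ℚ < p → ∀ k → 0ℚ < p ^ℚ k
^ℚ-pos p p>0 zero = positive⁻¹ 1ℚ
^ℚ-pos p p>0 (suc k) =
  positive⁻¹ (p * (p ^ℚ k))
    {{pos*pos⇒pos p {{positive p>0}} (p ^ℚ k) {{positive (^ℚ-pos p p>0 k)}}}}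

^ℚ-nonZero : ∀ p k → 0ℚ < p → NonZero (p ^ℚ k)
^ℚ-nonZero p k p>0 = >-nonZero (^ℚ-pos p p>0 k)

-- Fix δ = ε η n / 2 and choose greedily a maximal δ-separated family 𝓢 of the ε-heavy ranges.
-- Haussler's packing lemma bounds |𝓢| by (c n / δ)^d = (2c / εη)^d. Every heavy range R is
-- within distance δ of some S ∈ 𝓢, so |R △ S| is at most half of |S| and at most η |R|.
-- Hence R ∩ S is ½-heavy in the restriction to S, the ½-Mnet of (S, 𝓡|_S) contains some
-- M ⊆ R ∩ S with |M| ≥ λ |R ∩ S| ≥ λ (1 - η) |R|, and the union of these |𝓢| Mnets works.
module Submission where

open import Defs
open import Data.Nat using (ℕ)
open import Data.Rational using (ℚ; 0ℚ; 1ℚ; ½; _*_; _-_; _≤_; _<_; _÷_; _⊔_; >-nonZero)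
open import Data.Fin.Subset using (Subset; ⊤)
open import Data.List using (List; length)
open import Data.Product using (Σ; _×_)

import Data.Nat as ℕ
import Data.Nat.Properties as ℕP
open import Data.Integer as ℤ using (+_)
import Data.Integer.Properties as ℤP
open import Data.Integer.Tactic.RingSolver using (solve-∀)
import Data.Nat.Coprimality as Coprime
open import Data.Rational using (mkℚ; _+_; -_; 1/_; *≤*; *<*; positive; nonNegative)
import Data.Rational.Properties as QP
import Data.Rational.Unnormalised.Properties as ℚᵘ
open import Data.Rational.Unnormalised.Base using (*≡*)
open import Data.Rational.Solver using (module +-*-Solver)
open +-*-Solver using (solve; _:+_; _:*_; _:-_; _:=_; con)
open import Data.Fin.Subset using (∣_∣; _∩_; _─_; _⊆_) renaming (⊥ to ∅)
import Data.Fin.Subset.Properties as FSP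
open import Data.List using ([]; _∷_; _++_; concatMap)
import Data.List.Properties as LP
open import Data.List.Membership.Propositional using (_∈_; find; lose)
import Data.List.Membership.Propositional.Properties as MP
open import Data.List.Relation.Unary.Any using (here; there)
open import Data.List.Relation.Unary.All as All using (All; []; _∷_)
import Data.List.Relation.Unary.All.Properties as AllP
open import Data.List.Relation.Unary.AllPairs using (AllPairs; []; _∷_)
open import Data.Vec using ([]; _∷_)
open import Data.Bool using (true; false)
open import Data.Product using (_,_; proj₁; proj₂)
open import Data.Empty using (⊥-elim)
open import Function using (id; _∘_)
open import Relation.Nullary using (¬_; Dec; yes; no)
open import Relation.Binary.PropositionalEquality

coprimeTo-1 : ∀ k → Coprime.Coprime k 1
coprimeTo-1 k = Coprime.sym (Coprime.1-coprimeTo k)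

ℕ→ℚ≡mkℚ : ∀ k → ℕ→ℚ k ≡ mkℚ (+ k) 0 (coprimeTo-1 k)
ℕ→ℚ≡mkℚ k = QP.normalize-coprime (coprimeTo-1 k)

ℕ→ℚ-mono-≤ : ∀ {a b} → a ℕ.≤ b → ℕ→ℚ a ≤ ℕ→ℚ b
ℕ→ℚ-mono-≤ {a} {b} a≤b rewrite ℕ→ℚ≡mkℚ a | ℕ→ℚ≡mkℚ b =
  *≤* (subst₂ ℤ._≤_ (sym (ℤP.*-identityʳ (+ a))) (sym (ℤP.*-identityʳ (+ b))) (ℤ.+≤+ a≤b))

ℕ→ℚ-homo-+ : ∀ a b → ℕ→ℚ (a ℕ.+ b) ≡ ℕ→ℚ a + ℕ→ℚ b
ℕ→ℚ-homo-+ a b rewrite ℕ→ℚ≡mkℚ a | ℕ→ℚ≡mkℚ b | ℕ→ℚ≡mkℚ (a ℕ.+ b) =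
  QP.toℚᵘ-injective (ℚᵘ.≃-trans (*≡* (trans (cong (ℤ._* + 1) (ℤP.pos-+ a b)) (denominators-one (+ a) (+ b))))
                                (ℚᵘ.≃-sym (QP.toℚᵘ-homo-+ (mkℚ (+ a) 0 (coprimeTo-1 a)) (mkℚ (+ b) 0 (coprimeTo-1 b)))))
  where
  denominators-one : ∀ (x y : ℤ.ℤ) → (x ℤ.+ y) ℤ.* + 1 ≡ (x ℤ.* + 1 ℤ.+ y ℤ.* + 1) ℤ.* + 1
  denominators-one = solve-∀

ℕ→ℚ-nonNeg : ∀ k → 0ℚ ≤ ℕ→ℚ k
ℕ→ℚ-nonNeg k = ℕ→ℚ-mono-≤ {0} {k} ℕ.z≤n

0<1 : 0ℚ < 1ℚ
0<1 = QP.positive⁻¹ 1ℚ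

0<½ : 0ℚ < ½
0<½ = QP.positive⁻¹ ½

½≤1 : ½ ≤ 1ℚ
½≤1 = *≤* (ℤ.+≤+ (ℕ.s≤s ℕ.z≤n))

*-pos : ∀ {p q} → 0ℚ < p → 0ℚ < q → 0ℚ < p * q
*-pos {p} {q} p>0 q>0 = QP.positive⁻¹ (p * q) {{QP.pos*pos⇒pos p {{positive p>0}} q {{positive q>0}}}}

*-nonNeg : ∀ {p q} → 0ℚ ≤ p → 0ℚ ≤ q → 0ℚ ≤ p * q
*-nonNeg {p} {q} p≥0 q≥0 =
  QP.nonNegative⁻¹ (p * q) {{QP.nonNeg*nonNeg⇒nonNeg p {{nonNegative p≥0}} q {{nonNegative q≥0}}}}

*-monoˡ-≤ : ∀ {r p q} → 0ℚ ≤ r → p ≤ q → r * p ≤ r * q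
*-monoˡ-≤ {r} r≥0 = QP.*-monoˡ-≤-nonNeg r {{nonNegative r≥0}}

*-monoʳ-≤ : ∀ {r p q} → 0ℚ ≤ r → p ≤ q → p * r ≤ q * r
*-monoʳ-≤ {r} r≥0 = QP.*-monoʳ-≤-nonNeg r {{nonNegative r≥0}}

*-≤1 : ∀ {p q} → 0ℚ ≤ p → p ≤ 1ℚ → q ≤ 1ℚ → p * q ≤ 1ℚ
*-≤1 {p} p≥0 p≤1 q≤1 = QP.≤-trans (*-monoˡ-≤ p≥0 q≤1) (QP.≤-trans (QP.≤-reflexive (QP.*-identityʳ p)) p≤1)

[1-k]*b≤a : ∀ {a b t k} → b ≤ a + t → t ≤ k * b → (1ℚ - k) * b ≤ a
[1-k]*b≤a {a} {b} {t} {k} b≤a+t t≤kb = begin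
    (1ℚ - k) * b        ≡⟨ solve 2 (λ k b → (con 1ℚ :- k) :* b := b :- k :* b) refl k b ⟩
    b - k * b           ≤⟨ QP.+-monoˡ-≤ (- (k * b)) (QP.≤-trans b≤a+t (QP.+-monoʳ-≤ a t≤kb)) ⟩
    (a + k * b) - k * b ≡⟨ solve 2 (λ a x → (a :+ x) :- x := a) refl a (k * b) ⟩
    a                   ∎
  where open QP.≤-Reasoning

^ℚ-distribʳ-* : ∀ p q d → (p * q) ^ℚ d ≡ (p ^ℚ d) * (q ^ℚ d)
^ℚ-distribʳ-* p q ℕ.zero = refl
^ℚ-distribʳ-* p q (ℕ.suc d) rewrite ^ℚ-distribʳ-* p q d =
  solve 4 (λ p q P Q → (p :* q) :* (P :* Q) := (p :* P) :* (q :* Q)) refl p q (p ^ℚ d) (q ^ℚ d)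

^ℚ-nonNeg : ∀ {p} → 0ℚ ≤ p → ∀ d → 0ℚ ≤ p ^ℚ d
^ℚ-nonNeg p≥0 ℕ.zero = QP.<⇒≤ 0<1
^ℚ-nonNeg p≥0 (ℕ.suc d) = *-nonNeg p≥0 (^ℚ-nonNeg p≥0 d)

^ℚ-≤1 : ∀ {p} → 0ℚ ≤ p → p ≤ 1ℚ → ∀ d → p ^ℚ d ≤ 1ℚ
^ℚ-≤1 p≥0 p≤1 ℕ.zero = QP.≤-refl
^ℚ-≤1 p≥0 p≤1 (ℕ.suc d) = *-≤1 p≥0 p≤1 (^ℚ-≤1 p≥0 p≤1 d)

1≤^ℚ : ∀ {p} → 1ℚ ≤ p → ∀ d → 1ℚ ≤ p ^ℚ d
1≤^ℚ p≥1 ℕ.zero = QP.≤-refl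
1≤^ℚ {p} p≥1 (ℕ.suc d) = begin
    1ℚ           ≤⟨ p≥1 ⟩
    p            ≡⟨ sym (QP.*-identityʳ p) ⟩
    p * 1ℚ       ≤⟨ *-monoˡ-≤ (QP.≤-trans (QP.<⇒≤ 0<1) p≥1) (1≤^ℚ p≥1 d) ⟩
    p * p ^ℚ d   ∎
  where open QP.≤-Reasoning

∣q∣≤∣p∩q∣+∣q─p∣ : ∀ {n} (p q : Subset n) → ∣ q ∣ ℕ.≤ ∣ p ∩ q ∣ ℕ.+ ∣ q ─ p ∣
∣q∣≤∣p∩q∣+∣q─p∣ []          []          = ℕ.z≤n
∣q∣≤∣p∩q∣+∣q─p∣ (true ∷ p)  (true ∷ q)  = ℕ.s≤s (∣q∣≤∣p∩q∣+∣q─p∣ p q)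
∣q∣≤∣p∩q∣+∣q─p∣ (true ∷ p)  (false ∷ q) = ∣q∣≤∣p∩q∣+∣q─p∣ p q
∣q∣≤∣p∩q∣+∣q─p∣ (false ∷ p) (true ∷ q)  =
  ℕP.≤-trans (ℕ.s≤s (∣q∣≤∣p∩q∣+∣q─p∣ p q)) (ℕP.≤-reflexive (sym (ℕP.+-suc _ _)))
∣q∣≤∣p∩q∣+∣q─p∣ (false ∷ p) (false ∷ q) = ∣q∣≤∣p∩q∣+∣q─p∣ p q

∣q∣≤∣p∩q∣+∣p△q∣ : ∀ {n} (p q : Subset n) → ∣ q ∣ ℕ.≤ ∣ p ∩ q ∣ ℕ.+ ∣ p △ q ∣
∣q∣≤∣p∩q∣+∣p△q∣ p q =
  ℕP.≤-trans (∣q∣≤∣p∩q∣+∣q─p∣ p q) (ℕP.+-monoʳ-≤ ∣ p ∩ q ∣ (FSP.∣q∣≤∣p∪q∣ (p ─ q) (q ─ p)))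

∣p∣≤∣p∩q∣+∣p△q∣ : ∀ {n} (p q : Subset n) → ∣ p ∣ ℕ.≤ ∣ p ∩ q ∣ ℕ.+ ∣ p △ q ∣
∣p∣≤∣p∩q∣+∣p△q∣ p q = ℕP.≤-trans (∣q∣≤∣p∩q∣+∣q─p∣ q p)
  (ℕP.+-mono-≤ (ℕP.≤-reflexive (cong ∣_∣ (FSP.∩-comm q p))) (FSP.∣p∣≤∣p∪q∣ (p ─ q) (q ─ p)))

∣p△p∣≡0 : ∀ {n} (p : Subset n) → ∣ p △ p ∣ ≡ 0
∣p△p∣≡0 []          = refl
∣p△p∣≡0 (true ∷ p)  = ∣p△p∣≡0 p
∣p△p∣≡0 (false ∷ p) = ∣p△p∣≡0 p

module MaximalPacking {n : ℕ} (P : Subset n → Set) (P? : ∀ R → Dec (P R))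
                      (F : Subset n → Subset n → Set) (F? : ∀ R S → Dec (F R S))
                      (F-irrefl : ∀ R → ¬ F R R) where

  private
    insert : List (Subset n) → Subset n → List (Subset n)
    insert acc R with P? R | All.all? (F? R) acc
    ... | yes _ | yes _ = R ∷ acc
    ... | _     | _     = acc

    greedy : List (Subset n) → List (Subset n) → List (Subset n)
    greedy acc []       = acc
    greedy acc (R ∷ Rs) = greedy (insert acc R) Rs

    Invariant : (Subset n → Set) → List (Subset n) → Set
    Invariant Q acc = All (λ S → Q S × P S) acc × AllPairs F acc

    insert-invariant : ∀ {Q} acc R → Q R → Invariant Q acc → Invariant Q (insert acc R)
    insert-invariant acc R q inv with P? R | All.all? (F? R) acc
    ... | yes p | yes far = ((q , p) ∷ proj₁ inv) , (far ∷ proj₂ inv)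
    ... | yes _ | no _    = inv
    ... | no _  | _       = inv

    greedy-invariant : ∀ {Q} acc Rs → All Q Rs → Invariant Q acc → Invariant Q (greedy acc Rs)
    greedy-invariant acc []       _        inv = inv
    greedy-invariant acc (R ∷ Rs) (q ∷ qs) inv = greedy-invariant (insert acc R) Rs qs (insert-invariant acc R q inv)

    insert-⊇ : ∀ {S} acc R → S ∈ acc → S ∈ insert acc R
    insert-⊇ acc R S∈ with P? R | All.all? (F? R) acc
    ... | yes _ | yes _ = there S∈
    ... | yes _ | no _  = S∈
    ... | no _  | _     = S∈

    greedy-⊇ : ∀ {S} acc Rs → S ∈ acc → S ∈ greedy acc Rs
    greedy-⊇ acc []       S∈ = S∈
    greedy-⊇ acc (R ∷ Rs) S∈ = greedy-⊇ (insert acc R) Rs (insert-⊇ acc R S∈)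

    Blocked : List (Subset n) → Subset n → Set
    Blocked acc R = Σ (Subset n) λ S → S ∈ acc × ¬ F R S

    insert-blocks : ∀ acc R → P R → Blocked (insert acc R) R
    insert-blocks acc R p with P? R | All.all? (F? R) acc
    ... | yes _ | yes _   = R , here refl , F-irrefl R
    ... | yes _ | no ¬far = find (AllP.¬All⇒Any¬ (F? R) acc ¬far)
    ... | no ¬p | _       = ⊥-elim (¬p p)

    greedy-blocks : ∀ acc Rs R → R ∈ Rs → P R → Blocked (greedy acc Rs) R
    greedy-blocks acc (_ ∷ Rs) R (here refl) p =
      let S , S∈ , ¬far = insert-blocks acc R p in S , greedy-⊇ (insert acc R) Rs S∈ , ¬far
    greedy-blocks acc (R′ ∷ Rs) R (there R∈) p = greedy-blocks (insert acc R′) Rs R R∈ p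

  packing : List (Subset n) → List (Subset n)
  packing = greedy []

  packing-invariant : ∀ Rs → Invariant (_∈ Rs) (packing Rs)
  packing-invariant Rs = greedy-invariant [] Rs (All.tabulate id) ([] , [])

  packing-⊆ : ∀ Rs {S} → S ∈ packing Rs → S ∈ Rs
  packing-⊆ Rs S∈ = proj₁ (All.lookup (proj₁ (packing-invariant Rs)) S∈)

  packing-P : ∀ Rs {S} → S ∈ packing Rs → P S
  packing-P Rs S∈ = proj₂ (All.lookup (proj₁ (packing-invariant Rs)) S∈)

  packing-separated : ∀ Rs → AllPairs F (packing Rs)
  packing-separated Rs = proj₂ (packing-invariant Rs)

  packing-maximal : ∀ Rs {R} → R ∈ Rs → P R → Σ (Subset n) λ S → S ∈ packing Rs × ¬ F R S
  packing-maximal Rs {R} = greedy-blocks [] Rs R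

length-concatMap-≤ : ∀ {n} (f : Subset n → List (Subset n)) {Δ} (Ss : List (Subset n)) →
  (∀ S → ℕ→ℚ (length (f S)) ≤ Δ) → ℕ→ℚ (length (concatMap f Ss)) ≤ ℕ→ℚ (length Ss) * Δ
length-concatMap-≤ f {Δ} []       _     = QP.≤-reflexive (sym (QP.*-zeroˡ Δ))
length-concatMap-≤ f {Δ} (S ∷ Ss) f≤Δ = begin
    ℕ→ℚ (length (f S ++ concatMap f Ss))                ≡⟨ cong ℕ→ℚ (LP.length-++ (f S)) ⟩
    ℕ→ℚ (length (f S) ℕ.+ length (concatMap f Ss))      ≡⟨ ℕ→ℚ-homo-+ (length (f S)) _ ⟩
    ℕ→ℚ (length (f S)) + ℕ→ℚ (length (concatMap f Ss))  ≤⟨ QP.+-mono-≤ (f≤Δ S) (length-concatMap-≤ f Ss f≤Δ) ⟩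
    Δ + ℕ→ℚ (length Ss) * Δ                             ≡⟨ solve 2 (λ D s → D :+ s :* D := (con 1ℚ :+ s) :* D) refl Δ (ℕ→ℚ (length Ss)) ⟩
    (1ℚ + ℕ→ℚ (length Ss)) * Δ                          ≡⟨ cong (_* Δ) (sym (ℕ→ℚ-homo-+ 1 (length Ss))) ⟩
    ℕ→ℚ (ℕ.suc (length Ss)) * Δ                         ∎
  where open QP.≤-Reasoning

Heavy : ∀ {n} → ℚ → Subset n → Set
Heavy {n} ε R = ε * ℕ→ℚ ∣ ⊤ {n} ∣ ≤ ℕ→ℚ ∣ R ∩ ⊤ ∣

Far : ∀ {n} → ℚ → Subset n → Subset n → Set
Far δ R S = δ < ℕ→ℚ ∣ R △ S ∣

Heavy? : ∀ {n} ε (R : Subset n) → Dec (Heavy ε R)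
Heavy? {n} ε R = ε * ℕ→ℚ ∣ ⊤ {n} ∣ QP.≤? ℕ→ℚ ∣ R ∩ ⊤ ∣

Far? : ∀ {n} δ (R S : Subset n) → Dec (Far δ R S)
Far? δ R S = δ QP.<? ℕ→ℚ ∣ R △ S ∣

Far-irrefl : ∀ {n δ} → 0ℚ ≤ δ → (R : Subset n) → ¬ Far δ R R
Far-irrefl δ≥0 R far = QP.<-irrefl refl (QP.≤-<-trans δ≥0 (subst (λ k → _ < ℕ→ℚ k) (∣p△p∣≡0 R) far))

mnet-from-cover : ∀ {n} (𝓡 : SetSystem n) {lam μ κ ε} (𝓢 : List (Subset n)) (net : Subset n → List (Subset n)) →
  0ℚ ≤ lam → (∀ S → IsMnet S 𝓡 lam μ (net S)) →
  (∀ R → R ∈ 𝓡 → Heavy ε R →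
     Σ (Subset n) λ S → S ∈ 𝓢 × μ * ℕ→ℚ ∣ S ∣ ≤ ℕ→ℚ ∣ R ∩ S ∣ × κ * ℕ→ℚ ∣ R ∩ ⊤ ∣ ≤ ℕ→ℚ ∣ R ∩ S ∣) →
  IsMnet ⊤ 𝓡 (lam * κ) ε (concatMap net 𝓢)
mnet-from-cover {n} 𝓡 {lam} {κ = κ} {ε} 𝓢 net lam≥0 nets cover = (λ _ → FSP.⊆⊤) , heavy-piece
  where
  heavy-piece : ∀ R → R ∈ 𝓡 → Heavy ε R →
    Σ (Subset n) λ M → M ∈ concatMap net 𝓢 × M ⊆ R ∩ ⊤ × (lam * κ) * ℕ→ℚ ∣ R ∩ ⊤ ∣ ≤ ℕ→ℚ ∣ M ∣
  heavy-piece R R∈ R-heavy =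
    let S , S∈ , μ-overlap , κ-overlap = cover R R∈ R-heavy
        M , M∈ , M⊆R∩S , M-heavy = proj₂ (nets S) R R∈ μ-overlap
    in M
     , MP.∈-concatMap⁺ net (lose S∈ M∈)
     , subst (M ⊆_) (sym (FSP.∩-identityʳ R)) (proj₁ ∘ FSP.x∈p∩q⁻ R S ∘ M⊆R∩S)
     , (begin
      (lam * κ) * ℕ→ℚ ∣ R ∩ ⊤ ∣  ≡⟨ QP.*-assoc lam κ _ ⟩
      lam * (κ * ℕ→ℚ ∣ R ∩ ⊤ ∣)  ≤⟨ *-monoˡ-≤ lam≥0 κ-overlap ⟩
      lam * ℕ→ℚ ∣ R ∩ S ∣        ≤⟨ M-heavy ⟩
      ℕ→ℚ ∣ M ∣                  ∎)
    where open QP.≤-Reasoning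

separation : ℚ → ℚ → ℕ → ℚ
separation ε η n = ε * η * ½ * ℕ→ℚ n

separation-nonNeg : ∀ {ε η} → 0ℚ ≤ ε → 0ℚ ≤ η → ∀ n → 0ℚ ≤ separation ε η n
separation-nonNeg ε≥0 η≥0 n = *-nonNeg (*-nonNeg (*-nonNeg ε≥0 η≥0) (QP.<⇒≤ 0<½)) (ℕ→ℚ-nonNeg n)

close-heavy-overlap : ∀ {n ε η} (R S : Subset n) → 0ℚ ≤ η → η ≤ 1ℚ →
  Heavy ε R → Heavy ε S → ¬ Far (separation ε η n) R S →
  ½ * ℕ→ℚ ∣ S ∣ ≤ ℕ→ℚ ∣ R ∩ S ∣ × (1ℚ - η) * ℕ→ℚ ∣ R ∩ ⊤ ∣ ≤ ℕ→ℚ ∣ R ∩ S ∣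
close-heavy-overlap {n} {ε} {η} R S η≥0 η≤1 R-heavy S-heavy close =
    [1-k]*b≤a {k = ½} (in-ℚ ∣ R ∩ S ∣ ∣ R △ S ∣ (∣q∣≤∣p∩q∣+∣p△q∣ R S)) (distance≤ S ½ S-heavy η½≤½)
  , subst (λ T → (1ℚ - η) * ℕ→ℚ ∣ T ∣ ≤ ℕ→ℚ ∣ R ∩ S ∣) (sym (FSP.∩-identityʳ R))
      ([1-k]*b≤a {k = η} (in-ℚ ∣ R ∩ S ∣ ∣ R △ S ∣ (∣p∣≤∣p∩q∣+∣p△q∣ R S)) (distance≤ R η R-heavy η½≤η))
  where
  open QP.≤-Reasoning
  N = ℕ→ℚ n
  in-ℚ : ∀ {a} b c → a ℕ.≤ b ℕ.+ c → ℕ→ℚ a ≤ ℕ→ℚ b + ℕ→ℚ c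
  in-ℚ b c a≤b+c = QP.≤-trans (ℕ→ℚ-mono-≤ a≤b+c) (QP.≤-reflexive (ℕ→ℚ-homo-+ b c))
  η½≥0 : 0ℚ ≤ η * ½
  η½≥0 = *-nonNeg η≥0 (QP.<⇒≤ 0<½)
  η½≤½ : η * ½ ≤ ½
  η½≤½ = QP.≤-trans (*-monoʳ-≤ (QP.<⇒≤ 0<½) η≤1) (QP.≤-reflexive (QP.*-identityˡ ½))
  η½≤η : η * ½ ≤ η
  η½≤η = QP.≤-trans (*-monoˡ-≤ η≥0 ½≤1) (QP.≤-reflexive (QP.*-identityʳ η))
  distance≤ : ∀ (T : Subset n) k → Heavy ε T → η * ½ ≤ k → ℕ→ℚ ∣ R △ S ∣ ≤ k * ℕ→ℚ ∣ T ∣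
  distance≤ T k T-heavy η½≤k = begin
    ℕ→ℚ ∣ R △ S ∣       ≤⟨ QP.≮⇒≥ close ⟩
    ε * η * ½ * N       ≡⟨ solve 3 (λ ε η N → ε :* η :* con ½ :* N := (η :* con ½) :* (ε :* N)) refl ε η N ⟩
    (η * ½) * (ε * N)   ≤⟨ *-monoˡ-≤ η½≥0
                           (subst₂ (λ m U → ε * ℕ→ℚ m ≤ ℕ→ℚ ∣ U ∣) (FSP.∣⊤∣≡n n) (FSP.∩-identityʳ T) T-heavy) ⟩
    (η * ½) * ℕ→ℚ ∣ T ∣ ≤⟨ *-monoʳ-≤ (ℕ→ℚ-nonNeg ∣ T ∣) η½≤k ⟩
    k * ℕ→ℚ ∣ T ∣       ∎

haussler-2c≥1 : ∀ {c} → HausslerConstant c → 1ℚ ≤ ℕ→ℚ 2 * c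
haussler-2c≥1 {c} haussler = begin
    1ℚ                        ≤⟨ ℕ→ℚ-mono-≤ {1} {2} (ℕ.s≤s ℕ.z≤n) ⟩
    ℕ→ℚ 2                     ≤⟨ haussler 1 𝓡 1 (λ S _ → FSP.∣p∣≤n S) ½ 0<½ ½≤1 𝓡 id (far ∷ [] ∷ []) ⟩
    ((c * ℕ→ℚ 1) ÷ ½) ^ℚ 1    ≡⟨ solve 1 (λ c → (c :* con 1ℚ) :* con (1/ ½) :* con 1ℚ := con (ℕ→ℚ 2) :* c) refl c ⟩
    ℕ→ℚ 2 * c                 ∎
  where
  open QP.≤-Reasoning
  𝓡 : SetSystem 1
  𝓡 = ∅ ∷ ⊤ ∷ []
  far : All (Far ½ ∅) (⊤ ∷ [])
  far = *<* (ℤ.+<+ (ℕ.s≤s (ℕ.s≤s ℕ.z≤n))) ∷ []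

separated-Fin0-length≤1 : ∀ {δ} → 0ℚ ≤ δ → (𝓢 : List (Subset 0)) → AllPairs (Far δ) 𝓢 → length 𝓢 ℕ.≤ 1
separated-Fin0-length≤1 δ≥0 []            _                = ℕ.z≤n
separated-Fin0-length≤1 δ≥0 (_ ∷ [])      _                = ℕ.s≤s ℕ.z≤n
separated-Fin0-length≤1 δ≥0 ([] ∷ [] ∷ _) ((far ∷ _) ∷ _) = ⊥-elim (Far-irrefl δ≥0 [] far)

separated-size : ∀ {c} → HausslerConstant c → ∀ n (𝓡 : SetSystem n) d → VCdim≤ 𝓡 d →
  ∀ {ε η} → 0ℚ < ε → ε ≤ 1ℚ → 0ℚ < η → η ≤ 1ℚ →
  (𝓢 : List (Subset n)) → (∀ {S} → S ∈ 𝓢 → S ∈ 𝓡) → AllPairs (Far (separation ε η n)) 𝓢 →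
  ℕ→ℚ (length 𝓢) * ((ε ^ℚ d) * (η ^ℚ d)) ≤ (ℕ→ℚ 2 * c) ^ℚ d
-- For n = 0 the separation is 0, outside the range of Haussler's lemma, but then 𝓢 has at most one member.
separated-size {c} haussler ℕ.zero _ d _ {ε} {η} ε>0 ε≤1 η>0 η≤1 𝓢 _ separated = begin
    ℕ→ℚ (length 𝓢) * (ε ^ℚ d * η ^ℚ d) ≤⟨ *-monoʳ-≤ (*-nonNeg (^ℚ-nonNeg ε≥0 d) (^ℚ-nonNeg η≥0 d)) length≤1 ⟩
    1ℚ * (ε ^ℚ d * η ^ℚ d)             ≤⟨ *-≤1 (QP.<⇒≤ 0<1) QP.≤-refl (*-≤1 (^ℚ-nonNeg ε≥0 d) (^ℚ-≤1 ε≥0 ε≤1 d) (^ℚ-≤1 η≥0 η≤1 d)) ⟩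
    1ℚ                                 ≤⟨ 1≤^ℚ (haussler-2c≥1 {c} haussler) d ⟩
    (ℕ→ℚ 2 * c) ^ℚ d                   ∎
  where
  open QP.≤-Reasoning
  ε≥0 : 0ℚ ≤ ε
  ε≥0 = QP.<⇒≤ ε>0
  η≥0 : 0ℚ ≤ η
  η≥0 = QP.<⇒≤ η>0
  length≤1 : ℕ→ℚ (length 𝓢) ≤ 1ℚ
  length≤1 = ℕ→ℚ-mono-≤ (separated-Fin0-length≤1 (separation-nonNeg ε≥0 η≥0 0) 𝓢 separated)
separated-size {c} haussler n@(ℕ.suc _) 𝓡 d vc {ε} {η} ε>0 ε≤1 η>0 η≤1 𝓢 𝓢⊆𝓡 separated = begin
    ℕ→ℚ (length 𝓢) * (ε ^ℚ d * η ^ℚ d) ≤⟨ *-monoʳ-≤ εᵈηᵈ≥0 packing-bound ⟩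
    q ^ℚ d * (ε ^ℚ d * η ^ℚ d)         ≡⟨ cong (q ^ℚ d *_) (sym (^ℚ-distribʳ-* ε η d)) ⟩
    q ^ℚ d * (ε * η) ^ℚ d              ≡⟨ sym (^ℚ-distribʳ-* q (ε * η) d) ⟩
    (q * (ε * η)) ^ℚ d                 ≡⟨ cong (_^ℚ d) q*εη≡2c ⟩
    (ℕ→ℚ 2 * c) ^ℚ d                   ∎
  where
  open QP.≤-Reasoning
  N = ℕ→ℚ n
  δ = separation ε η n
  N>0 : 0ℚ < N
  N>0 = QP.<-≤-trans 0<1 (ℕ→ℚ-mono-≤ {1} {n} (ℕ.s≤s ℕ.z≤n))
  δ>0 : 0ℚ < δ
  δ>0 = *-pos (*-pos (*-pos ε>0 η>0) 0<½) N>0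
  δ≤N : δ ≤ N
  δ≤N = QP.≤-trans (*-monoʳ-≤ (QP.<⇒≤ N>0) εη½≤1) (QP.≤-reflexive (QP.*-identityˡ N))
    where
    εη½≤1 : ε * η * ½ ≤ 1ℚ
    εη½≤1 = *-≤1 (*-nonNeg (QP.<⇒≤ ε>0) (QP.<⇒≤ η>0)) (*-≤1 (QP.<⇒≤ ε>0) ε≤1 η≤1) ½≤1
  q = ((c * N) ÷ δ) {{>-nonZero δ>0}}
  packing-bound : ℕ→ℚ (length 𝓢) ≤ q ^ℚ d
  packing-bound = haussler n 𝓡 d vc δ δ>0 δ≤N 𝓢 𝓢⊆𝓡 separated
  εᵈηᵈ≥0 : 0ℚ ≤ ε ^ℚ d * η ^ℚ d
  εᵈηᵈ≥0 = *-nonNeg (^ℚ-nonNeg (QP.<⇒≤ ε>0) d) (^ℚ-nonNeg (QP.<⇒≤ η>0) d)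
  q*εη≡2c : q * (ε * η) ≡ ℕ→ℚ 2 * c
  q*εη≡2c = begin-equality
    (c * N) * 1/δ * (ε * η)   ≡⟨ solve 5 (λ c N iδ ε η → (c :* N) :* iδ :* (ε :* η)
                                           := (con (ℕ→ℚ 2) :* c) :* (((ε :* η :* con ½) :* N) :* iδ))
                                 refl c N 1/δ ε η ⟩
    ℕ→ℚ 2 * c * (δ * 1/δ)     ≡⟨ cong (ℕ→ℚ 2 * c *_) (QP.*-inverseʳ δ {{>-nonZero δ>0}}) ⟩
    ℕ→ℚ 2 * c * 1ℚ            ≡⟨ QP.*-identityʳ (ℕ→ℚ 2 * c) ⟩
    ℕ→ℚ 2 * c                 ∎
    where
    1/δ = (1/ δ) {{>-nonZero δ>0}}

size-bound : ∀ {s A Δ E H} (E>0 : 0ℚ < E) (H>0 : 0ℚ < H) (T : ℚ) → 0ℚ ≤ A → 0ℚ ≤ Δ → s * (E * H) ≤ A →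
  s * Δ ≤ 1ℚ * ((A * Δ) ÷ E) {{>-nonZero E>0}} * (T ⊔ (1ℚ ÷ H) {{>-nonZero H>0}})
size-bound {s} {A} {Δ} {E} {H} E>0 H>0 T A≥0 Δ≥0 s*EH≤A = begin
    s * Δ                               ≤⟨ *-monoʳ-≤ Δ≥0 s≤A/EH ⟩
    (A * (1/E * 1/H)) * Δ               ≡⟨ solve 4 (λ A D iE iH → (A :* (iE :* iH)) :* D := con 1ℚ :* ((A :* D) :* iE) :* (con 1ℚ :* iH))
                                           refl A Δ 1/E 1/H ⟩
    1ℚ * ((A * Δ) * 1/E) * (1ℚ * 1/H)   ≤⟨ *-monoˡ-≤ (*-nonNeg (QP.<⇒≤ 0<1) (*-nonNeg (*-nonNeg A≥0 Δ≥0) 1/E≥0)) (QP.p≤q⊔p T (1ℚ * 1/H)) ⟩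
    1ℚ * ((A * Δ) * 1/E) * (T ⊔ (1ℚ * 1/H)) ∎
  where
  open QP.≤-Reasoning
  1/E = (1/ E) {{>-nonZero E>0}}
  1/H = (1/ H) {{>-nonZero H>0}}
  1/E≥0 : 0ℚ ≤ 1/E
  1/E≥0 = QP.<⇒≤ (QP.positive⁻¹ 1/E {{QP.1/pos⇒pos E {{positive E>0}}}})
  1/H≥0 : 0ℚ ≤ 1/H
  1/H≥0 = QP.<⇒≤ (QP.positive⁻¹ 1/H {{QP.1/pos⇒pos H {{positive H>0}}}})
  s≤A/EH : s ≤ A * (1/E * 1/H)
  s≤A/EH = begin
    s                             ≡⟨ solve 1 (λ s → s := s :* con 1ℚ :* con 1ℚ) refl s ⟩
    s * 1ℚ * 1ℚ                   ≡⟨ sym (cong₂ (λ a b → s * a * b) (QP.*-inverseʳ E {{>-nonZero E>0}}) (QP.*-inverseʳ H {{>-nonZero H>0}})) ⟩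
    s * (E * 1/E) * (H * 1/H)     ≡⟨ solve 5 (λ s E H iE iH → s :* (E :* iE) :* (H :* iH) := s :* (E :* H) :* (iE :* iH)) refl s E H 1/E 1/H ⟩
    s * (E * H) * (1/E * 1/H)     ≤⟨ *-monoʳ-≤ (*-nonNeg 1/E≥0 1/H≥0) s*EH≤A ⟩
    A * (1/E * 1/H)               ∎

lemma4p1 : Σ ℚ λ C → 0ℚ < C ×
    (∀ (c : ℚ) → HausslerConstant c →
     ∀ (n : ℕ) (𝓡 : SetSystem n) (d : ℕ) → VCdim≤ 𝓡 d →
     ∀ (lam Δ : ℚ) → 0ℚ < lam → lam < 1ℚ → 1ℚ ≤ Δ →
     (∀ (Y : Subset n) → Σ (List (Subset n)) λ 𝓜 → IsMnet Y 𝓡 lam ½ 𝓜 × ℕ→ℚ (length 𝓜) ≤ Δ) →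
     ∀ (ε η : ℚ) → (ε>0 : 0ℚ < ε) → ε < 1ℚ → (η>0 : 0ℚ < η) → η < 1ℚ →
     Σ (List (Subset n)) λ 𝓜 →
       IsMnet ⊤ 𝓡 (lam * (1ℚ - η)) ε 𝓜 ×
       ℕ→ℚ (length 𝓜) ≤
         C * ((((ℕ→ℚ 2 * c) ^ℚ d) * Δ) ÷ (ε ^ℚ d)) {{ ^ℚ-nonZero ε d ε>0 }}
           * ((ℕ→ℚ 2 ^ℚ d) ⊔ (1ℚ ÷ (η ^ℚ d)) {{ ^ℚ-nonZero η d η>0 }}))
lemma4p1 = 1ℚ , 0<1 , λ c haussler n 𝓡 d vc lam Δ lam>0 _ 1≤Δ nets ε η ε>0 ε<1 η>0 η<1 →
  let δ = separation ε η n
      ε≥0 = QP.<⇒≤ ε>0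
      η≥0 = QP.<⇒≤ η>0
      open MaximalPacking {n} (Heavy ε) (Heavy? ε) (Far δ) (Far? δ) (Far-irrefl (separation-nonNeg ε≥0 η≥0 n))
      𝓢 = packing 𝓡
      net = λ S → proj₁ (nets S)
      cover = λ R R∈ R-heavy →
        let S , S∈ , close = packing-maximal 𝓡 R∈ R-heavy
        in S , S∈ , close-heavy-overlap {ε = ε} R S η≥0 (QP.<⇒≤ η<1) R-heavy (packing-P 𝓡 S∈) close
  in concatMap net 𝓢
   , mnet-from-cover 𝓡 {μ = ½} {κ = 1ℚ - η} {ε} 𝓢 net (QP.<⇒≤ lam>0) (λ S → proj₁ (proj₂ (nets S))) cover
   , QP.≤-trans (length-concatMap-≤ net 𝓢 (λ S → proj₂ (proj₂ (nets S))))
       (size-bound {ℕ→ℚ (length 𝓢)} (^ℚ-pos ε ε>0 d) (^ℚ-pos η η>0 d) (ℕ→ℚ 2 ^ℚ d)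
         (^ℚ-nonNeg (QP.≤-trans (QP.<⇒≤ 0<1) (haussler-2c≥1 {c} haussler)) d) (QP.≤-trans (QP.<⇒≤ 0<1) 1≤Δ)
         (separated-size {c} haussler n 𝓡 d vc ε>0 (QP.<⇒≤ ε<1) η>0 (QP.<⇒≤ η<1) 𝓢 (packing-⊆ 𝓡) (packing-separated 𝓡)))
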